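{- Let $Y$ be a minimally non-firm generalised binary matrix (in particular, possibly a binary matrix). Then every row and every column of $Y$ contains at least two non-zero entries (entries equal to $1$ or $?$).
   Context: A generalised binary matrix is a matrix $Y$ with entries in $\{0,1,?\}$; $\operatorname{supp}(Y)$ is the set of positions of entries equal to $1$. A rectangle is a submatrix $I\times J$ containing no $0$. $br(Y)$ is the minimum number of rectangles whose union contains $\operatorname{supp}(Y)$; an isolated set is a subset of $\operatorname{supp}(Y)$ no two elements of which lie in a common rectangle, and $i(Y)$ is the maximum size of an isolated set. $Y$ is minimally non-firm if $i(Y)<br(Y)$ and $i(Y')=br(Y')$ for every proper submatrix $Y'$ of $Y$ (obtained by deleting at least one row or column). -}

module Defs where

open import Data.Nat using (ℕ; _<_; _≤_; _+_)
open import Data.Fin using (Fin) renaming (_<_ to _<ᶠ_)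
open import Data.Fin.Subset using (Subset; _∈_)
open import Data.Product using (Σ; ∃; ∃-syntax; _×_; _,_)
open import Relation.Binary.PropositionalEquality using (_≡_; _≢_)
open import Relation.Nullary using (¬_)

data Entry : Set where
  𝟘 𝟙 ⁇ : Entry

Matrix : ℕ → ℕ → Set
Matrix m n = Fin m → Fin n → Entry

Position : ℕ → ℕ → Set
Position m n = Fin m × Fin n

InSupp : ∀ {m n} → Matrix m n → Position m n → Set
InSupp Y (i , j) = Y i j ≡ 𝟙

record Rectangle {m n : ℕ} (Y : Matrix m n) : Set where
  constructor rect
  field
    rows : Subset m
    cols : Subset n
    noZero : ∀ i j → i ∈ rows → j ∈ cols → Y i j ≢ 𝟘

_∈R_ : ∀ {m n} {Y : Matrix m n} → Position m n → Rectangle Y → Set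
(i , j) ∈R R = i ∈ Rectangle.rows R × j ∈ Rectangle.cols R

Cover : ∀ {m n} → Matrix m n → ℕ → Set
Cover Y b = Σ (Fin b → Rectangle Y) λ Rs →
  ∀ p → InSupp Y p → ∃[ k ] (p ∈R Rs k)

IsBr : ∀ {m n} → Matrix m n → ℕ → Set
IsBr Y b = Cover Y b × (∀ b' → Cover Y b' → b ≤ b')

Isolated : ∀ {m n} → Matrix m n → ℕ → Set
Isolated Y a = Σ (Fin a → Position _ _) λ f →
  (∀ k → InSupp Y (f k)) ×
  (∀ k l → k ≢ l → f k ≢ f l) ×
  (∀ k l → k ≢ l → ¬ (Σ (Rectangle Y) λ R → f k ∈R R × f l ∈R R))

IsI : ∀ {m n} → Matrix m n → ℕ → Set
IsI Y a = Isolated Y a × (∀ a' → Isolated Y a' → a' ≤ a)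

StrictMono : ∀ {k m} → (Fin k → Fin m) → Set
StrictMono f = ∀ x y → x <ᶠ y → f x <ᶠ f y

sub : ∀ {m n m' n'} → Matrix m n → (Fin m' → Fin m) → (Fin n' → Fin n) → Matrix m' n'
sub Y f g i j = Y (f i) (g j)

ProperSub : ∀ {m n m' n'} → Matrix m n → Matrix m' n' → Set
ProperSub {m} {n} {m'} {n'} Y Y' =
  Σ (Fin m' → Fin m) λ f → Σ (Fin n' → Fin n) λ g →
    StrictMono f × StrictMono g × (m' + n' < m + n) × (∀ i j → Y' i j ≡ sub Y f g i j)

Firm : ∀ {m n} → Matrix m n → Set
Firm Y = ∀ a b → IsI Y a → IsBr Y b → a ≡ b

MinNonFirm : ∀ {m n} → Matrix m n → Set
MinNonFirm {m} {n} Y =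
  (∃[ a ] ∃[ b ] (IsI Y a × IsBr Y b × a < b)) ×
  (∀ m' n' (Y' : Matrix m' n') → ProperSub Y Y' → Firm Y')

RowTwoNonZero : ∀ {m n} → Matrix m n → Fin m → Set
RowTwoNonZero Y i = ∃[ j ] ∃[ j' ] (j ≢ j' × Y i j ≢ 𝟘 × Y i j' ≢ 𝟘)

ColTwoNonZero : ∀ {m n} → Matrix m n → Fin n → Set
ColTwoNonZero Y j = ∃[ i ] ∃[ i' ] (i ≢ i' × Y i j ≢ 𝟘 × Y i' j ≢ 𝟘)

-- Suppose row i of Y has fewer than two non-zero entries.  If row i contains no 1,
-- delete it: isolated sets and covers of the smaller matrix Y' carry over to Y.  Otherwise
-- its only non-zero entry is a 1 at (i, j); delete column j: a cover of Y' needs one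
-- extra rectangle (the non-zero part of column j), and an isolated set of Y' extends by
-- (i, j), because a rectangle through (i, j) and a point outside column j would meet a
-- second non-zero entry of row i.  Either way i(Y) - i(Y') ≥ br(Y) - br(Y'), which
-- contradicts i(Y) < br(Y) and i(Y') = br(Y').  Transposition reduces columns to rows, and
-- the second case to deleting a row.  The extrema i and br exist only up to double
-- negation, which is enough because the conclusion is decidable.
module Submission where

open import Defs
open import Data.Nat using (ℕ)
open import Data.Fin using (Fin)
open import Data.Product using (_×_)

open import Data.Bool using (Bool; true; false)
open import Data.Empty using (⊥; ⊥-elim)
open import Data.Fin using (zero; suc; punchIn)
open import Data.Fin.Properties
  using (any?; <⇒≢; punchIn-injective; punchInᵢ≢i; punchIn-punchOut; punchIn-mono-≤; injective⇒≤)
  renaming (_≟_ to _≟ᶠ_; ≤∧≢⇒< to ≤∧≢⇒<ᶠ)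
open import Data.Fin.Subset using (Subset; _∈_; _∉_; outside; ⁅_⁆)
open import Data.Fin.Subset.Properties using (x∈⁅x⁆; x∈⁅y⁆⇒x≡y)
open import Data.Nat using (zero; suc; _+_; _≤_; _<_)
open import Data.Nat.Induction using (<-rec)
open import Data.Nat.Properties
  using (≮⇒≥; ≤-pred; <⇒≤; ≤∧≢⇒<; 1+n≰n; n<1+n; +-comm; <-≤-trans; ≤-trans; <-irrefl)
open import Data.Product using (Σ; ∃; ∃-syntax; _,_; proj₁; proj₂; swap)
import Data.Product as Product
open import Data.Vec using (tabulate; lookup; insertAt)
open import Data.Vec.Functional using () renaming (_∷_ to _◂_)
open import Data.Vec.Properties
  using (lookup∘tabulate; []=⇒lookup; lookup⇒[]=; insertAt-lookup; insertAt-punchIn)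
open import Effect.Monad using (RawMonad)
open import Function using (id; _∘_)
open import Level using (0ℓ)
open import Relation.Binary.Definitions using (DecidableEquality)
open import Relation.Binary.PropositionalEquality
  using (_≡_; _≢_; refl; sym; trans; cong; cong₂; subst; subst₂)
open import Relation.Nullary using (¬_; Dec; yes; no; contradiction; ¬?; _×-dec_)
open import Relation.Nullary.Decidable using (decidable-stable; ¬¬-excluded-middle)
open import Relation.Nullary.Negation using (¬¬-Monad)

open RawMonad (¬¬-Monad {a = 0ℓ}) using (return; _>>=_)

private
  variable
    m n m' n' a b c : ℕ

Least Greatest : (ℕ → Set) → ℕ → Set
Least P k = P k × (∀ k' → P k' → k ≤ k')
Greatest P k = P k × (∀ k' → P k' → k' ≤ k)

¬¬-least : (P : ℕ → Set) {k : ℕ} → P k → ¬ ¬ ∃ (Least P)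
¬¬-least P {k} = <-rec (λ k → P k → ¬ ¬ ∃ (Least P)) step k
  where
  step : ∀ k → (∀ {k'} → k' < k → P k' → ¬ ¬ ∃ (Least P)) → P k → ¬ ¬ ∃ (Least P)
  step k below pk = ¬¬-excluded-middle {A = ∃ λ k' → k' < k × P k'} >>= λ where
    (yes (k' , k'<k , pk')) → below k'<k pk'
    (no none) → return (k , pk , λ k' pk' → ≮⇒≥ λ k'<k → none (k' , k'<k , pk'))

-- The greatest element of P is read off the least upper bound of P.
¬¬-greatest : (P : ℕ → Set) → P 0 → (∀ k → P k → k ≤ b) → ¬ ¬ ∃ (Greatest P)
¬¬-greatest P p0 bounded = ¬¬-least UpperBound bounded >>= λ where
    (zero , ub , _) → return (0 , p0 , ub)
    (suc d , ub , least) → ¬¬-excluded-middle {A = P (suc d)} >>= λ where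
      (yes pd) → return (suc d , pd , ub)
      (no ¬pd) → contradiction (least d (λ k pk → ≤-pred (≤∧≢⇒< (ub k pk) (λ { refl → ¬pd pk }))))
                               1+n≰n
  where
  UpperBound : ℕ → Set
  UpperBound d = ∀ k → P k → k ≤ d

_≟ₑ_ : DecidableEquality Entry
𝟘 ≟ₑ 𝟘 = yes refl
𝟘 ≟ₑ 𝟙 = no λ ()
𝟘 ≟ₑ ⁇ = no λ ()
𝟙 ≟ₑ 𝟘 = no λ ()
𝟙 ≟ₑ 𝟙 = yes refl
𝟙 ≟ₑ ⁇ = no λ ()
⁇ ≟ₑ 𝟘 = no λ ()
⁇ ≟ₑ 𝟙 = no λ ()
⁇ ≟ₑ ⁇ = yes refl

≡𝟙⇒≢𝟘 : ∀ {e} → e ≡ 𝟙 → e ≢ 𝟘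
≡𝟙⇒≢𝟘 refl ()

nonZero : Entry → Bool
nonZero 𝟘 = false
nonZero _ = true

nonZero⇒≢𝟘 : ∀ e → nonZero e ≡ true → e ≢ 𝟘
nonZero⇒≢𝟘 𝟙 _ ()
nonZero⇒≢𝟘 ⁇ _ ()

≡𝟙⇒nonZero : ∀ {e} → e ≡ 𝟙 → nonZero e ≡ true
≡𝟙⇒nonZero refl = refl

∈-tabulate⁺ : (p : Fin n → Bool) {x : Fin n} → p x ≡ true → x ∈ tabulate p
∈-tabulate⁺ p {x} px = lookup⇒[]= x _ (trans (lookup∘tabulate p x) px)

∈-tabulate⁻ : (p : Fin n → Bool) {x : Fin n} → x ∈ tabulate p → p x ≡ true
∈-tabulate⁻ p {x} x∈ = trans (sym (lookup∘tabulate p x)) ([]=⇒lookup x∈)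

preimage : (Fin m' → Fin m) → Subset m → Subset m'
preimage f S = tabulate (lookup S ∘ f)

∈-preimage⁺ : ∀ (f : Fin m' → Fin m) {S y} → f y ∈ S → y ∈ preimage f S
∈-preimage⁺ f fy∈ = ∈-tabulate⁺ _ ([]=⇒lookup fy∈)

∈-preimage⁻ : ∀ (f : Fin m' → Fin m) {S y} → y ∈ preimage f S → f y ∈ S
∈-preimage⁻ f y∈ = lookup⇒[]= _ _ (∈-tabulate⁻ _ y∈)

∈-insertAt⁺ : ∀ {S : Subset m} {y} i {v} → y ∈ S → punchIn i y ∈ insertAt S i v
∈-insertAt⁺ {S = S} {y} i {v} y∈ =
  lookup⇒[]= _ _ (trans (insertAt-punchIn S i v y) ([]=⇒lookup y∈))

∈-insertAt⁻ : ∀ {S : Subset m} {y} i {v} → punchIn i y ∈ insertAt S i v → y ∈ S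
∈-insertAt⁻ {S = S} {y} i {v} y∈ =
  lookup⇒[]= _ _ (trans (sym (insertAt-punchIn S i v y)) ([]=⇒lookup y∈))

∉-insertAt-outside : ∀ {S : Subset m} i → i ∉ insertAt S i outside
∉-insertAt-outside {S = S} i i∈ with trans (sym (insertAt-lookup S i outside)) ([]=⇒lookup i∈)
... | ()

data PunchView (i : Fin (suc m)) : Fin (suc m) → Set where
  at  : PunchView i i
  off : (y : Fin m) → PunchView i (punchIn i y)

punchView : (i x : Fin (suc m)) → PunchView i x
punchView i x with x ≟ᶠ i
... | yes refl = at
... | no x≢i = subst (PunchView i) (punchIn-punchOut (x≢i ∘ sym)) (off _)

punchIn-strictMono : (i : Fin (suc m)) → StrictMono (punchIn i)
punchIn-strictMono i x y x<y =
  ≤∧≢⇒<ᶠ (punchIn-mono-≤ i x y (<⇒≤ x<y))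
         (<⇒≢ x<y ∘ punchIn-injective i x y)

rowRect : (Y : Matrix m n) → Fin m → Rectangle Y
rowRect Y k = rect ⁅ k ⁆ (tabulate (nonZero ∘ Y k)) λ x l x∈ l∈ →
  subst (λ x → Y x l ≢ 𝟘) (sym (x∈⁅y⁆⇒x≡y k x∈)) (nonZero⇒≢𝟘 _ (∈-tabulate⁻ _ l∈))

∈-rowRect : (Y : Matrix m n) → ∀ {k l} → Y k l ≡ 𝟙 → _∈R_ {Y = Y} (k , l) (rowRect Y k)
∈-rowRect Y {k} one = x∈⁅x⁆ k , ∈-tabulate⁺ _ (≡𝟙⇒nonZero one)

rowCover : (Y : Matrix m n) → Cover Y m
rowCover Y = rowRect Y , λ { (k , l) one → k , ∈-rowRect Y one }

isolated≤cover : {Y : Matrix m n} → Isolated Y a → Cover Y b → a ≤ b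
isolated≤cover {a = a} {Y = Y} (P , supp , _ , separated) (Rs , covers) = injective⇒≤ rectOf-injective
  where
  rectOf : Fin a → Fin _
  rectOf k = proj₁ (covers (P k) (supp k))

  rectOf-injective : ∀ {k l} → rectOf k ≡ rectOf l → k ≡ l
  rectOf-injective {k} {l} eq with k ≟ᶠ l
  ... | yes k≡l = k≡l
  ... | no k≢l = ⊥-elim (separated k l k≢l (Rs (rectOf l) ,
          subst (λ r → _∈R_ {Y = Y} (P k) (Rs r)) eq (proj₂ (covers (P k) (supp k))) ,
          proj₂ (covers (P l) (supp l))))

isolated-empty : (Y : Matrix m n) → Isolated Y 0
isolated-empty Y = (λ ()) , (λ ()) , (λ ()) , (λ ())

Isolated-cons : {Y : Matrix m n} (q : Position m n) → InSupp Y q → ((P , _) : Isolated Y a) →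
  (∀ k → q ≢ P k) → (∀ k → ¬ Σ (Rectangle Y) λ R → _∈R_ {Y = Y} q R × _∈R_ {Y = Y} (P k) R) →
  Isolated Y (suc a)
Isolated-cons {a = a} {Y = Y} q q-supp (P , supp , distinct , separated) q≢ q-separated =
  Q , Q-supp , Q-distinct , Q-separated
  where
  Q : Fin (suc a) → Position _ _
  Q = q ◂ P

  Q-supp : ∀ k → InSupp Y (Q k)
  Q-supp zero = q-supp
  Q-supp (suc k) = supp k

  Q-distinct : ∀ k l → k ≢ l → Q k ≢ Q l
  Q-distinct zero zero k≢l = contradiction refl k≢l
  Q-distinct zero (suc l) _ = q≢ l
  Q-distinct (suc k) zero _ = q≢ k ∘ sym
  Q-distinct (suc k) (suc l) k≢l = distinct k l (k≢l ∘ cong suc)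

  Q-separated : ∀ k l → k ≢ l → ¬ Σ (Rectangle Y) λ R → _∈R_ {Y = Y} (Q k) R × _∈R_ {Y = Y} (Q l) R
  Q-separated zero zero k≢l = contradiction refl k≢l
  Q-separated zero (suc l) _ = q-separated l
  Q-separated (suc k) zero _ (R , Pk∈ , q∈) = q-separated k (R , q∈ , Pk∈)
  Q-separated (suc k) (suc l) k≢l = separated k l (k≢l ∘ cong suc)

restrictRect : {Y : Matrix m n} (f : Fin m' → Fin m) (g : Fin n' → Fin n) →
  Rectangle Y → Rectangle (sub Y f g)
restrictRect f g (rect R C noZero) = rect (preimage f R) (preimage g C) λ x y x∈ y∈ →
  noZero (f x) (g y) (∈-preimage⁻ f x∈) (∈-preimage⁻ g y∈)

Isolated-sub : {Y : Matrix m n} {f : Fin m' → Fin m} {g : Fin n' → Fin n} →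
  (∀ {x y} → f x ≡ f y → x ≡ y) → (∀ {x y} → g x ≡ g y → x ≡ y) →
  Isolated (sub Y f g) a → Isolated Y a
Isolated-sub {f = f} {g} f-inj g-inj (P , supp , distinct , separated) =
  Product.map f g ∘ P , supp ,
  (λ k l k≢l eq → distinct k l k≢l (cong₂ _,_ (f-inj (cong proj₁ eq)) (g-inj (cong proj₂ eq)))) ,
  λ { k l k≢l (R , (xk , yk) , (xl , yl)) → separated k l k≢l (restrictRect f g R ,
        (∈-preimage⁺ f xk , ∈-preimage⁺ g yk) , (∈-preimage⁺ f xl , ∈-preimage⁺ g yl)) }

Transfer : ℕ → Matrix m' n' → Matrix m n → Set
Transfer c Y' Y = (∀ a → Isolated Y' a → Isolated Y (c + a)) × (∀ b → Cover Y' b → Cover Y (c + b))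

¬¬-IsBr : (Y : Matrix m n) → ¬ ¬ ∃ (IsBr Y)
¬¬-IsBr Y = ¬¬-least (Cover Y) (rowCover Y)

¬¬-IsI : (Y : Matrix m n) → ¬ ¬ ∃ (IsI Y)
¬¬-IsI Y = ¬¬-greatest (Isolated Y) (isolated-empty Y) (λ a I → isolated≤cover I (rowCover Y))

-- i(Y) ≥ c + i(Y') = c + br(Y') ≥ br(Y) contradicts i(Y) < br(Y).
MinNonFirm⇒¬Transfer : {Y : Matrix m n} {Y' : Matrix m' n'} →
  MinNonFirm Y → ProperSub Y Y' → ¬ Transfer c Y' Y
MinNonFirm⇒¬Transfer {c = c} {Y' = Y'} ((a , b , (_ , greatest) , (_ , least) , a<b) , subFirm) sub
  (transferIsolated , transferCover) =
  ¬¬-IsI Y' λ { (a' , IA') → ¬¬-IsBr Y' λ { (b' , IB') →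
    gap a' b' IA' IB' (subFirm _ _ Y' sub a' b' IA' IB') } }
  where
  gap : ∀ a' b' → IsI Y' a' → IsBr Y' b' → a' ≡ b' → ⊥
  gap a' b' (I' , _) (C' , _) refl = <-irrefl refl (<-≤-trans a<b (≤-trans
    (least (c + b') (transferCover b' C'))
    (greatest (c + a') (transferIsolated a' I'))))

removeRow : Matrix (suc m) n → Fin (suc m) → Matrix m n
removeRow Y i = sub Y (punchIn i) id

removeRow-properSub : (Y : Matrix (suc m) n) (i : Fin (suc m)) → ProperSub Y (removeRow Y i)
removeRow-properSub {m} {n} Y i =
  punchIn i , id , punchIn-strictMono i , (λ _ _ x<y → x<y) , n<1+n (m + n) , λ _ _ → refl

Isolated-removeRow : (Y : Matrix (suc m) n) (i : Fin (suc m)) →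
  Isolated (removeRow Y i) a → Isolated Y a
Isolated-removeRow Y i = Isolated-sub (punchIn-injective i _ _) id

extendRect : (Y : Matrix (suc m) n) (i : Fin (suc m)) → Rectangle (removeRow Y i) → Rectangle Y
extendRect Y i (rect R C noZero) = rect (insertAt R i outside) C noZero'
  where
  noZero' : ∀ x l → x ∈ insertAt R i outside → l ∈ C → Y x l ≢ 𝟘
  noZero' x l x∈ l∈ with punchView i x
  ... | at = contradiction x∈ (∉-insertAt-outside i)
  ... | off y = noZero y l (∈-insertAt⁻ i x∈) l∈

coveredOffRow : (Y : Matrix (suc m) n) (i : Fin (suc m)) ((Rs , _) : Cover (removeRow Y i) b) →
  ∀ y l → Y (punchIn i y) l ≡ 𝟙 → ∃[ k ] (_∈R_ {Y = Y} (punchIn i y , l) (extendRect Y i (Rs k)))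
coveredOffRow Y i (Rs , covers) y l one with covers (y , l) one
... | k , y∈ , l∈ = k , ∈-insertAt⁺ i y∈ , l∈

oneFreeRow-transfer : (Y : Matrix (suc m) n) (i : Fin (suc m)) →
  (∀ l → Y i l ≢ 𝟙) → Transfer 0 (removeRow Y i) Y
oneFreeRow-transfer Y i noOne =
  (λ a → Isolated-removeRow Y i) ,
  λ b C → extendRect Y i ∘ proj₁ C , λ { (x , l) one → covered C x l one }
  where
  covered : ∀ {b} (C : Cover (removeRow Y i) b) x l → Y x l ≡ 𝟙 →
    ∃[ k ] (_∈R_ {Y = Y} (x , l) (extendRect Y i (proj₁ C k)))
  covered C x l one with punchView i x
  ... | at = contradiction one (noOne l)
  ... | off y = coveredOffRow Y i C y l one

-- The extra rectangle is row i; the extra isolated point is (i, j).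
soleNonZeroInColumn-transfer : (Y : Matrix (suc m) n) (i : Fin (suc m)) (j : Fin n) →
  Y i j ≡ 𝟙 → (∀ k → Y k j ≢ 𝟘 → k ≡ i) → Transfer 1 (removeRow Y i) Y
soleNonZeroInColumn-transfer Y i j one sole =
  (λ a I → Isolated-cons (i , j) one (Isolated-removeRow Y i I)
    (λ k eq → punchInᵢ≢i i _ (sym (cong proj₁ eq)))
    λ { k (R , (_ , j∈) , (x∈ , _)) →
      punchInᵢ≢i i _ (sole _ (Rectangle.noZero R _ j x∈ j∈)) }) ,
  λ b C → rowRect Y i ◂ (extendRect Y i ∘ proj₁ C) , λ { (x , l) one → covered C x l one }
  where
  covered : ∀ {b} (C : Cover (removeRow Y i) b) x l → Y x l ≡ 𝟙 →
    ∃[ k ] (_∈R_ {Y = Y} (x , l) ((rowRect Y i ◂ (extendRect Y i ∘ proj₁ C)) k))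
  covered C x l one with punchView i x
  ... | at = zero , ∈-rowRect Y one
  ... | off y with coveredOffRow Y i C y l one
  ...   | k , p∈ = suc k , p∈

_ᵀ : Matrix m n → Matrix n m
(Y ᵀ) j i = Y i j

Rectangle-ᵀ : {Y : Matrix m n} → Rectangle Y → Rectangle (Y ᵀ)
Rectangle-ᵀ (rect R C noZero) = rect C R λ j i j∈ i∈ → noZero i j i∈ j∈

Isolated-ᵀ : {Y : Matrix m n} → Isolated Y a → Isolated (Y ᵀ) a
Isolated-ᵀ (P , supp , distinct , separated) =
  swap ∘ P , supp ,
  (λ k l k≢l eq → distinct k l k≢l (cong swap eq)) ,
  λ { k l k≢l (R , (jk , ik) , (jl , il)) → separated k l k≢l (Rectangle-ᵀ R , (ik , jk) , (il , jl)) }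

Cover-ᵀ : {Y : Matrix m n} → Cover Y b → Cover (Y ᵀ) b
Cover-ᵀ (Rs , covers) = Rectangle-ᵀ ∘ Rs , λ { (j , i) one →
  let (k , i∈ , j∈) = covers (i , j) one in k , j∈ , i∈ }

IsI-ᵀ : {Y : Matrix m n} → IsI Y a → IsI (Y ᵀ) a
IsI-ᵀ (I , greatest) = Isolated-ᵀ I , λ a' I' → greatest a' (Isolated-ᵀ I')

IsBr-ᵀ : {Y : Matrix m n} → IsBr Y b → IsBr (Y ᵀ) b
IsBr-ᵀ (C , least) = Cover-ᵀ C , λ b' C' → least b' (Cover-ᵀ C')

ProperSub-ᵀ : {Y : Matrix m n} {Y' : Matrix m' n'} → ProperSub (Y ᵀ) Y' → ProperSub Y (Y' ᵀ)
ProperSub-ᵀ {m} {n} {m'} {n'} (f , g , f-mono , g-mono , smaller , entries) =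
  g , f , g-mono , f-mono ,
  subst₂ _<_ (+-comm m' n') (+-comm n m) smaller , λ i j → entries j i

MinNonFirm-ᵀ : {Y : Matrix m n} → MinNonFirm Y → MinNonFirm (Y ᵀ)
MinNonFirm-ᵀ {Y = Y} ((a , b , IA , IB , a<b) , subFirm) =
  (a , b , IsI-ᵀ IA , IsBr-ᵀ IB , a<b) ,
  λ m' n' Y' sub a' b' IA' IB' →
    subFirm n' m' (Y' ᵀ) (ProperSub-ᵀ {Y = Y} sub) a' b' (IsI-ᵀ IA') (IsBr-ᵀ IB')

¬oneFreeRow : {Y : Matrix m n} → MinNonFirm Y → (i : Fin m) → ¬ (∀ l → Y i l ≢ 𝟙)
¬oneFreeRow {suc m} {Y = Y} mnf i noOne =
  MinNonFirm⇒¬Transfer mnf (removeRow-properSub Y i) (oneFreeRow-transfer Y i noOne)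

¬soleNonZeroInColumn : {Y : Matrix m n} → MinNonFirm Y → (i : Fin m) (j : Fin n) →
  Y i j ≡ 𝟙 → ¬ (∀ k → Y k j ≢ 𝟘 → k ≡ i)
¬soleNonZeroInColumn {suc m} {Y = Y} mnf i j one sole =
  MinNonFirm⇒¬Transfer mnf (removeRow-properSub Y i) (soleNonZeroInColumn-transfer Y i j one sole)

¬soleNonZeroInRow : {Y : Matrix m n} → MinNonFirm Y → (i : Fin m) (j : Fin n) →
  Y i j ≡ 𝟙 → ¬ (∀ l → Y i l ≢ 𝟘 → l ≡ j)
¬soleNonZeroInRow mnf i j = ¬soleNonZeroInColumn (MinNonFirm-ᵀ mnf) j i

rowTwoNonZero? : (Y : Matrix m n) (i : Fin m) → Dec (RowTwoNonZero Y i)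
rowTwoNonZero? Y i = any? λ j → any? λ j' →
  ¬? (j ≟ᶠ j') ×-dec ¬? (Y i j ≟ₑ 𝟘) ×-dec ¬? (Y i j' ≟ₑ 𝟘)

minNonFirm⇒rowTwoNonZero : {Y : Matrix m n} → MinNonFirm Y → ∀ i → RowTwoNonZero Y i
minNonFirm⇒rowTwoNonZero {Y = Y} mnf i = decidable-stable (rowTwoNonZero? Y i) λ ¬two →
  case (any? λ l → Y i l ≟ₑ 𝟙) ¬two
  where
  case : Dec (∃ λ l → Y i l ≡ 𝟙) → ¬ RowTwoNonZero Y i → ⊥
  case (no noOne) _ = ¬oneFreeRow mnf i λ l one → noOne (l , one)
  case (yes (j , one)) ¬two = ¬soleNonZeroInRow mnf i j one sole
    where
    sole : ∀ l → Y i l ≢ 𝟘 → l ≡ j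
    sole l nz with l ≟ᶠ j
    ... | yes l≡j = l≡j
    ... | no l≢j = contradiction (j , l , l≢j ∘ sym , ≡𝟙⇒≢𝟘 one , nz) ¬two

lemma5 : ∀ {m n} (Y : Matrix m n) → MinNonFirm Y →
    (∀ (i : Fin m) → RowTwoNonZero Y i) × (∀ (j : Fin n) → ColTwoNonZero Y j)
lemma5 Y mnf = minNonFirm⇒rowTwoNonZero mnf , minNonFirm⇒rowTwoNonZero (MinNonFirm-ᵀ mnf)
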